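{- Let $a\neq b$ be letters, let $k,l$ be non-negative integers not both zero, and let $m$ be a positive integer with prime factorization $m=p_1^{e_1}\cdots p_s^{e_s}$. (i) Over $\mathbb{Z}$, \[ l^*(a^kba^l)=(-1)^k\binom{k+l}{k}\,l^*(ba^{k+l})=(-1)^k\binom{k+l}{k}\bigl(ba^{k+l}-aba^{k+l-1}\bigr). \] (ii) The word $a^kba^l$ does not lie in the support of $\mathcal{L}_{\mathbb{Z}_m}(A)$ if and only if for each $i\in\{1,\dots,s\}$ the number of carries in the addition of $k$ and $l$ in base $p_i$ is at least $e_i$.
   Context: $A$ is a finite alphabet containing $a,b$. For a commutative ring $K$ with unity, $K\langle A\rangle$ is the free associative algebra, $(P,w)$ the coefficient of word $w$ in $P$, scalar product $(P,Q)=\sum_w(P,w)(Q,w)$. $\mathcal{L}_K(A)$ is the Lie subalgebra (bracket $[P,Q]=PQ-QP$) generated by $A$; its support is the set of words $w$ with $(P,w)\neq0$ for some $P\in\mathcal{L}_K(A)$. $\mathbb{Z}_m=\mathbb{Z}/m\mathbb{Z}$. The left normed bracketing: $l(\epsilon)=0$, $l(a)=a$, $l(ua)=[l(u),a]$, extended linearly; $l^*$ is the linear endomorphism with $(l^*(u),v)=(l(v),u)$ for all words $u,v$ (equivalently $l^*(a)=a$, $l^*(aub)=l^*(au)b-l^*(ub)a$). The number of carries in base-$p$ addition of $k$ and $l$ is the number of positions at which a carry occurs when adding their base-$p$ expansions digit by digit. -}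

module Defs where

open import Data.Nat as ℕ using (ℕ; zero; suc; _≤_; _<ᵇ_; _≤ᵇ_)
open import Data.Nat.DivMod using (_/_; _%_)
open import Data.Nat.Primality using (Prime)
open import Data.Integer as ℤ using (ℤ; +_; _-_; _*_; -_)
open import Data.Integer.Divisibility using () renaming (_∣_ to _∣ℤ_)
open import Data.Fin as Fin using (Fin)
open import Data.List using (List; []; _∷_; _++_; map; concatMap; replicate; reverse; foldr)
open import Data.Nat.ListAction using (product)
open import Data.List.Properties using (≡-dec)
open import Data.List.Relation.Unary.All using (All)
open import Data.List.Relation.Unary.AllPairs using (AllPairs)
open import Data.Product using (_×_; _,_; Σ; ∃; proj₁)
open import Data.Bool using (if_then_else_)
open import Relation.Nullary using (¬_; does)
open import Relation.Binary.PropositionalEquality using (_≡_; _≢_)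

Word : ℕ → Set
Word n = List (Fin n)

_≟w_ : ∀ {n} (u v : Word n) → Relation.Nullary.Dec (u ≡ v)
_≟w_ = ≡-dec Fin._≟_

-- Polynomials of ℤ⟨A⟩ as formal finite linear combinations of words
Poly : ℕ → Set
Poly n = List (ℤ × Word n)

coeff : ∀ {n} → Poly n → Word n → ℤ
coeff [] w = + 0
coeff ((c , u) ∷ P) w = (if does (u ≟w w) then c else + 0) ℤ.+ coeff P w

letter : ∀ {n} → Fin n → Poly n
letter x = (+ 1 , x ∷ []) ∷ []

wordP : ∀ {n} → Word n → Poly n
wordP u = (+ 1 , u) ∷ []

_⊕_ : ∀ {n} → Poly n → Poly n → Poly n
P ⊕ Q = P ++ Q

_·_ : ∀ {n} → ℤ → Poly n → Poly n
c · P = map (λ { (d , u) → (c * d , u) }) P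

⊖_ : ∀ {n} → Poly n → Poly n
⊖ P = (- + 1) · P

_⊗_ : ∀ {n} → Poly n → Poly n → Poly n
P ⊗ Q = concatMap (λ { (c , u) → map (λ { (d , v) → (c * d , u ++ v) }) Q }) P

⟦_,_⟧ : ∀ {n} → Poly n → Poly n → Poly n
⟦ P , Q ⟧ = (P ⊗ Q) ⊕ (⊖ (Q ⊗ P))

-- Scalars are integers; over ℤ_m these represent all scalars of ℤ_m.
data IsLie {n : ℕ} : Poly n → Set where
  lie-letter  : (x : Fin n) → IsLie (letter x)
  lie-add     : ∀ {P Q} → IsLie P → IsLie Q → IsLie (P ⊕ Q)
  lie-smul    : ∀ {P} (c : ℤ) → IsLie P → IsLie (c · P)
  lie-bracket : ∀ {P Q} → IsLie P → IsLie Q → IsLie ⟦ P , Q ⟧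

-- support of L_{ℤ_m}(A): ℤ_m-coefficients are integers modulo m,
-- a coefficient is nonzero in ℤ_m iff m does not divide it.
InSupportMod : ∀ {n} → ℕ → Word n → Set
InSupportMod {n} m w = Σ (Poly n) λ P → IsLie P × ¬ ((+ m) ∣ℤ coeff P w)

-- left normed bracketing, computed on the reversed word
lrev : ∀ {n} → Word n → Poly n
lrev [] = []
lrev (x ∷ []) = letter x
lrev (x ∷ y ∷ r) = ⟦ lrev (y ∷ r) , letter x ⟧

l : ∀ {n} → Word n → Poly n
l w = lrev (reverse w)

-- l* as the adjoint: (l*(u), v) = (l(v), u); lstar u is the coefficient function of l*(u)
lstar : ∀ {n} → Word n → Word n → ℤ
lstar u v = coeff (l v) u

carriesAux : ℕ → ℕ → ℕ → ℕ → ℕ → ℕ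
carriesAux zero p c k l = 0
carriesAux (suc fuel) zero c k l = 0
carriesAux (suc fuel) (suc zero) c k l = 0
carriesAux (suc fuel) p@(suc (suc q)) c k l =
  let s = k % p ℕ.+ l % p ℕ.+ c
      out = if p ≤ᵇ s then 1 else 0
  in out ℕ.+ carriesAux fuel p out (k / p) (l / p)

-- k + l + 1 positions are more than enough for any base p ≥ 2
carries : ℕ → ℕ → ℕ → ℕ
carries p k l = carriesAux (k ℕ.+ l ℕ.+ 1) p 0 k l

IsPrimeFactorization : ℕ → List (ℕ × ℕ) → Set
IsPrimeFactorization m fs =
  All (λ { (p , e) → Prime p × 1 ≤ e }) fs
  × AllPairs (λ x y → proj₁ x ≢ proj₁ y) fs
  × product (map (λ { (p , e) → p ℕ.^ e }) fs) ≡ m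

-- Every Lie element P satisfies, by induction on how P is generated, (P, ε) = 0, (P, aⁿ) = 0 for
-- n ≥ 2, and (P, aⁱbaʲ) = (-1)ⁱ C(i+j,i) (P, baⁱ⁺ʲ): in a bracket only the splittings of aⁱbaʲ
-- that peel off a single letter a contribute, and the two resulting binomials add up by Pascal's
-- rule. Taking P = l(v) gives (i), since baᴺ occurs in l(v) only for v = baᴺ and v = abaᴺ⁻¹.
-- So the Lie element l(baᵏ⁺ˡ) has coefficient ±C(k+l,k) at aᵏbaˡ while every Lie coefficient there
-- is a multiple of C(k+l,k): aᵏbaˡ leaves the support over ℤ_m exactly when m ∣ C(k+l,k). Kummer's theorem, obtained from Legendre's formula one base-p digit
-- at a time, turns pᵢ^eᵢ ∣ C(k+l,k) into "at least eᵢ carries".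
module Submission where

open import Defs
open import Data.Nat using (ℕ; suc)
open import Data.Nat.Primality using (Prime)
open import Data.Fin as Fin using (Fin)
open import Data.List using (List; []; _∷_; [_]; _++_; _∷ʳ_; map; replicate; reverse)
open import Data.List.Properties using (unfold-reverse; reverse-++; ∷-injectiveˡ; ∷-injectiveʳ; reverse-injective)
open import Data.Product using (Σ; _×_; _,_)
open import Data.Bool using (true; false; if_then_else_)
open import Function using (_∘_)
open import Relation.Nullary using (Dec; does; yes; no)
open import Relation.Nullary.Decidable using (dec-true; dec-false; does-⇔)
open import Function.Bundles using (_⇔_; mk⇔)
open import Relation.Binary.PropositionalEquality hiding ([_])

lrev-IsLie : ∀ {n} (x : Fin n) r → IsLie (lrev (x ∷ r))
lrev-IsLie x [] = lie-letter x
lrev-IsLie x (y ∷ r) = lie-bracket (lrev-IsLie y r) (lie-letter x)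

module Coefficients {n : ℕ} where

  open import Data.Integer using (ℤ; +_; -_; _+_; _*_; _-_)
  import Data.Integer.Properties as ℤ
  open import Algebra.Properties.CommutativeSemigroup ℤ.+-commutativeSemigroup
    using () renaming (interchange to +-interchange)

  mono : ℤ → Word n → Word n → ℤ
  mono c u w = if does (u ≟w w) then c else + 0

  δ : Word n → Word n → ℤ
  δ = mono (+ 1)

  mono-≡ : ∀ {u w} c → u ≡ w → mono c u w ≡ c
  mono-≡ {u} {w} c u≡w rewrite dec-true (u ≟w w) u≡w = refl

  mono-≢ : ∀ {u w} c → u ≢ w → mono c u w ≡ + 0
  mono-≢ {u} {w} c u≢w rewrite dec-false (u ≟w w) u≢w = refl

  mono-⇔ : ∀ c {u w u' w'} → (u ≡ w ⇔ u' ≡ w') → mono c u w ≡ mono c u' w'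
  mono-⇔ c {u} {w} {u'} {w'} u≡w⇔u'≡w' =
    cong (if_then c else + 0) (does-⇔ u≡w⇔u'≡w' (u ≟w w) (u' ≟w w'))

  mono-∷ : ∀ c x u w → mono c (x ∷ u) (x ∷ w) ≡ mono c u w
  mono-∷ c x u w = mono-⇔ c {x ∷ u} {x ∷ w} {u} {w} (mk⇔ ∷-injectiveʳ (cong (x ∷_)))

  mono-∷-≢ : ∀ c {x y} u w → x ≢ y → mono c (x ∷ u) (y ∷ w) ≡ + 0
  mono-∷-≢ c {x} {y} u w x≢y = mono-≢ {x ∷ u} {y ∷ w} c (x≢y ∘ ∷-injectiveˡ)

  δ-∷ : ∀ x u y w → δ (x ∷ u) (y ∷ w) ≡ δ [ x ] [ y ] * δ u w
  δ-∷ x u y w = byHead (x Fin.≟ y)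
    where
    byHead : Dec (x ≡ y) → δ (x ∷ u) (y ∷ w) ≡ δ [ x ] [ y ] * δ u w
    byHead (yes refl) = trans (mono-∷ (+ 1) x u w)
      (sym (trans (cong (_* δ u w) (mono-≡ {[ x ]} {[ x ]} (+ 1) refl)) (ℤ.*-identityˡ (δ u w))))
    byHead (no x≢y) = trans (mono-∷-≢ (+ 1) u w x≢y)
      (sym (trans (cong (_* δ u w) (mono-∷-≢ (+ 1) {x} {y} [] [] x≢y)) (ℤ.*-zeroˡ (δ u w))))

  δ-reverse : ∀ u w → δ (reverse u) (reverse w) ≡ δ u w
  δ-reverse u w = mono-⇔ (+ 1) {reverse u} {reverse w} {u} {w} (mk⇔ reverse-injective (cong reverse))

  coeff-++ : ∀ (P Q : Poly n) w → coeff (P ++ Q) w ≡ coeff P w + coeff Q w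
  coeff-++ [] Q w = sym (ℤ.+-identityˡ (coeff Q w))
  coeff-++ ((c , u) ∷ P) Q w =
    trans (cong (_+_ (mono c u w)) (coeff-++ P Q w)) (sym (ℤ.+-assoc (mono c u w) (coeff P w) (coeff Q w)))

  mono-scale : ∀ c d u w → mono (c * d) u w ≡ c * mono d u w
  mono-scale c d u w with does (u ≟w w)
  ... | true = refl
  ... | false = sym (ℤ.*-zeroʳ c)

  coeff-· : ∀ c (P : Poly n) w → coeff (c · P) w ≡ c * coeff P w
  coeff-· c [] w = sym (ℤ.*-zeroʳ c)
  coeff-· c ((d , u) ∷ P) w =
    trans (cong₂ _+_ (mono-scale c d u w) (coeff-· c P w)) (sym (ℤ.*-distribˡ-+ c (mono d u w) (coeff P w)))

  -- (f ⋆ g) w = Σ_{u v = w} f u * g v, the coefficient of w in a product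
  infixl 7 _⋆_
  _⋆_ : (Word n → ℤ) → (Word n → ℤ) → Word n → ℤ
  (f ⋆ g) [] = f [] * g []
  (f ⋆ g) (x ∷ w) = f [] * g (x ∷ w) + ((f ∘ (x ∷_)) ⋆ g) w

  ⋆-congˡ : ∀ {f f'} g → (∀ u → f u ≡ f' u) → ∀ w → (f ⋆ g) w ≡ (f' ⋆ g) w
  ⋆-congˡ g f≗f' [] = cong (_* g []) (f≗f' [])
  ⋆-congˡ g f≗f' (x ∷ w) = cong₂ _+_ (cong (_* g (x ∷ w)) (f≗f' [])) (⋆-congˡ g (f≗f' ∘ (x ∷_)) w)

  ⋆-zeroˡ : ∀ {f} g → (∀ u → f u ≡ + 0) → ∀ w → (f ⋆ g) w ≡ + 0
  ⋆-zeroˡ g f≗0 [] rewrite f≗0 [] = refl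
  ⋆-zeroˡ g f≗0 (x ∷ w) rewrite f≗0 [] = trans (ℤ.+-identityˡ _) (⋆-zeroˡ g (f≗0 ∘ (x ∷_)) w)

  ⋆-distribʳ-+ : ∀ f₁ f₂ g w → ((λ u → f₁ u + f₂ u) ⋆ g) w ≡ (f₁ ⋆ g) w + (f₂ ⋆ g) w
  ⋆-distribʳ-+ f₁ f₂ g [] = ℤ.*-distribʳ-+ (g []) (f₁ []) (f₂ [])
  ⋆-distribʳ-+ f₁ f₂ g (x ∷ w)
    rewrite ⋆-distribʳ-+ (f₁ ∘ (x ∷_)) (f₂ ∘ (x ∷_)) g w | ℤ.*-distribʳ-+ (g (x ∷ w)) (f₁ []) (f₂ []) =
    +-interchange (f₁ [] * g (x ∷ w)) (f₂ [] * g (x ∷ w)) (((f₁ ∘ (x ∷_)) ⋆ g) w) (((f₂ ∘ (x ∷_)) ⋆ g) w)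

  leftMul : ℤ → Word n → ℤ × Word n → ℤ × Word n
  leftMul c u (d , v) = (c * d , u ++ v)

  coeff-leftMul : ∀ c u (Q : Poly n) w → coeff (map (leftMul c u) Q) w ≡ (mono c u ⋆ coeff Q) w
  coeff-leftMul c [] Q w = trans (coeff-· c Q w) (sym (unit w))
    where
    unit : ∀ w → (mono c [] ⋆ coeff Q) w ≡ c * coeff Q w
    unit [] = refl
    unit (x ∷ w) = trans (cong (_+_ (c * coeff Q (x ∷ w))) (⋆-zeroˡ (coeff Q) (λ _ → refl) w)) (ℤ.+-identityʳ _)
  coeff-leftMul c (y ∷ u) Q [] = at-ε Q
    where
    at-ε : ∀ Q → coeff (map (leftMul c (y ∷ u)) Q) [] ≡ + 0
    at-ε [] = refl
    at-ε ((d , v) ∷ Q) rewrite at-ε Q = refl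
  coeff-leftMul c (y ∷ u) Q (x ∷ w) = byHead (y Fin.≟ x)
    where
    byHead : Dec (y ≡ x) → coeff (map (leftMul c (y ∷ u)) Q) (x ∷ w) ≡ (mono c (y ∷ u) ⋆ coeff Q) (x ∷ w)
    byHead (yes refl) = trans (shift Q) (trans (coeff-leftMul c u Q w)
                          (sym (trans (ℤ.+-identityˡ _) (⋆-congˡ (coeff Q) (mono-∷ c y u) w))))
      where
      shift : ∀ Q → coeff (map (leftMul c (y ∷ u)) Q) (y ∷ w) ≡ coeff (map (leftMul c u) Q) w
      shift [] = refl
      shift ((d , v) ∷ Q) = cong₂ _+_ (mono-∷ (c * d) y (u ++ v) w) (shift Q)
    byHead (no y≢x) =
      trans (vanish Q) (sym (trans (ℤ.+-identityˡ _) (⋆-zeroˡ (coeff Q) (λ t → mono-∷-≢ c u t y≢x) w)))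
      where
      vanish : ∀ Q → coeff (map (leftMul c (y ∷ u)) Q) (x ∷ w) ≡ + 0
      vanish [] = refl
      vanish ((d , v) ∷ Q) rewrite vanish Q | mono-∷-≢ (c * d) (u ++ v) w y≢x = refl

  coeff-⊗ : ∀ (P Q : Poly n) w → coeff (P ⊗ Q) w ≡ (coeff P ⋆ coeff Q) w
  coeff-⊗ [] Q w = sym (⋆-zeroˡ (coeff Q) (λ _ → refl) w)
  coeff-⊗ ((c , u) ∷ P) Q w = begin
    coeff (map (leftMul c u) Q ++ P ⊗ Q) w               ≡⟨ coeff-++ (map (leftMul c u) Q) (P ⊗ Q) w ⟩
    coeff (map (leftMul c u) Q) w + coeff (P ⊗ Q) w      ≡⟨ cong₂ _+_ (coeff-leftMul c u Q w) (coeff-⊗ P Q w) ⟩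
    (mono c u ⋆ coeff Q) w + (coeff P ⋆ coeff Q) w       ≡⟨ ⋆-distribʳ-+ (mono c u) (coeff P) (coeff Q) w ⟨
    (coeff ((c , u) ∷ P) ⋆ coeff Q) w                    ∎
    where open ≡-Reasoning

  coeff-⟦⟧ : ∀ (P Q : Poly n) w → coeff ⟦ P , Q ⟧ w ≡ (coeff P ⋆ coeff Q) w - (coeff Q ⋆ coeff P) w
  coeff-⟦⟧ P Q w = trans (coeff-++ (P ⊗ Q) (⊖ (Q ⊗ P)) w)
    (cong₂ _+_ (coeff-⊗ P Q w)
      (trans (coeff-· (- + 1) (Q ⊗ P) w) (trans (ℤ.-1*i≡-i _) (cong -_ (coeff-⊗ Q P w)))))

  ⋆-at-letter : ∀ {f g} → f [] ≡ + 0 → g [] ≡ + 0 → ∀ z → (f ⋆ g) [ z ] ≡ + 0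
  ⋆-at-letter {f} {g} f[]≡0 g[]≡0 z rewrite f[]≡0 | g[]≡0 | ℤ.*-zeroʳ (f [ z ]) = refl

  coeff-letter : ∀ x w → coeff (letter x) w ≡ δ [ x ] w
  coeff-letter x w = ℤ.+-identityʳ (δ [ x ] w)

  coeff-letter-∷∷ : ∀ x y z w → coeff (letter x) (y ∷ z ∷ w) ≡ + 0
  coeff-letter-∷∷ x y z w = cong (λ c → c + + 0) (mono-≢ {[ x ]} {y ∷ z ∷ w} (+ 1) λ ())

module LieShape {n : ℕ} (a b : Fin n) where

  open Coefficients {n}
  open import Data.Nat as ℕ using (zero; suc)
  import Data.Nat.Properties as ℕ
  open import Data.Nat.Combinatorics using (_C_; nCk+nC[k+1]≡[n+1]C[k+1]; k>n⇒nCk≡0)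
  open import Data.Integer using (ℤ; +_; -_; _+_; _*_; _-_; _^_; ∣_∣)
  open import Data.Nat.Divisibility using (_∣_; _∣?_; ∣m⇒∣m*n)
  open import Relation.Nullary using (¬_; contradiction)
  open import Relation.Nullary.Decidable using (decidable-stable)
  import Data.Integer.Properties as ℤ
  open import Data.Integer.Tactic.RingSolver using (solve-∀)
  open import Algebra.Properties.CommutativeSemigroup ℤ.*-commutativeSemigroup
    using () renaming (x∙yz≈y∙xz to *-x∙yz≈y∙xz)

  a^ : ℕ → Word n
  a^ i = replicate i a

  aⁱbaʲ : ℕ → ℕ → Word n
  aⁱbaʲ i j = a^ i ++ b ∷ a^ j

  sgn : ℕ → ℤ
  sgn i = (- + 1) ^ i

  record ALinear (f : Word n → ℤ) : Set where
    field
      at-ε  : f [] ≡ + 0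
      at-aa : ∀ r → f (a ∷ a ∷ a^ r) ≡ + 0
  open ALinear

  -- the terms of (f ⋆ g) (aⁱbaʲ i j) that split off a leading resp. trailing letter a
  firstSplit lastSplit : (Word n → ℤ) → (Word n → ℤ) → ℕ → ℕ → ℤ
  firstSplit f g zero    j = + 0
  firstSplit f g (suc i) j = f [ a ] * g (aⁱbaʲ i j)
  lastSplit f g i zero    = + 0
  lastSplit f g i (suc j) = f (aⁱbaʲ i j) * g [ a ]

  ⋆-a^ : ∀ {g} → ALinear g → ∀ f j → (f ⋆ g) (a^ (suc j)) ≡ f (a^ j) * g [ a ]
  ⋆-a^ {g} G f zero rewrite at-ε G | ℤ.*-zeroʳ (f [ a ]) = ℤ.+-identityʳ (f [] * g [ a ])
  ⋆-a^ {g} G f (suc j) rewrite at-aa G j | ℤ.*-zeroʳ (f []) = trans (ℤ.+-identityˡ _) (⋆-a^ G (f ∘ (a ∷_)) j)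

  ⋆-suffix : ∀ {g} → ALinear g → ∀ f i j → ((λ u → f (a^ i ++ b ∷ u)) ⋆ g) (a^ j) ≡ lastSplit f g i j
  ⋆-suffix G f i zero rewrite at-ε G = ℤ.*-zeroʳ (f (aⁱbaʲ i 0))
  ⋆-suffix G f i (suc j) = ⋆-a^ G (λ u → f (a^ i ++ b ∷ u)) j

  ⋆-prefix : ∀ {f} g → (∀ r → f (a^ r) ≡ + 0) → ∀ i j →
    (f ⋆ g) (aⁱbaʲ i j) ≡ ((λ u → f (a^ i ++ b ∷ u)) ⋆ g) (a^ j)
  ⋆-prefix g f≗0 zero j rewrite f≗0 0 = ℤ.+-identityˡ _
  ⋆-prefix g f≗0 (suc i) j rewrite f≗0 0 = trans (ℤ.+-identityˡ _) (⋆-prefix g (f≗0 ∘ suc) i j)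

  ⋆-after-a : ∀ {f} g → (∀ r → f (a ∷ a^ r) ≡ + 0) → ∀ i j →
    (f ⋆ g) (aⁱbaʲ i j) ≡ f [] * g (aⁱbaʲ i j) + ((λ u → f (a^ i ++ b ∷ u)) ⋆ g) (a^ j)
  ⋆-after-a g f∘a≗0 zero j = refl
  ⋆-after-a {f} g f∘a≗0 (suc i) j = cong (_+_ (f [] * g (aⁱbaʲ (suc i) j))) (⋆-prefix g f∘a≗0 i j)

  ⋆-aⁱbaʲ : ∀ {f g} → ALinear f → ALinear g → ∀ i j →
    (f ⋆ g) (aⁱbaʲ i j) ≡ firstSplit f g i j + lastSplit f g i j
  ⋆-aⁱbaʲ {f} {g} F G zero j = cong₂ (λ x y → x * g (b ∷ a^ j) + y) (at-ε F) (⋆-suffix G f 0 j)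
  ⋆-aⁱbaʲ {f} {g} F G (suc i) j rewrite at-ε F = begin
    + 0 + ((f ∘ (a ∷_)) ⋆ g) (aⁱbaʲ i j)
      ≡⟨ ℤ.+-identityˡ _ ⟩
    ((f ∘ (a ∷_)) ⋆ g) (aⁱbaʲ i j)
      ≡⟨ ⋆-after-a g (at-aa F) i j ⟩
    first + ((λ u → f (a ∷ a^ i ++ b ∷ u)) ⋆ g) (a^ j)
      ≡⟨ cong (_+_ first) (⋆-suffix G (f ∘ (a ∷_)) i j) ⟩
    first + lastSplit (f ∘ (a ∷_)) g i j
      ≡⟨ cong (_+_ first) (lastSplit-a∷ j) ⟩
    first + lastSplit f g (suc i) j ∎
    where
    open ≡-Reasoning
    first = f [ a ] * g (aⁱbaʲ i j)
    lastSplit-a∷ : ∀ j → lastSplit (f ∘ (a ∷_)) g i j ≡ lastSplit f g (suc i) j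
    lastSplit-a∷ zero = refl
    lastSplit-a∷ (suc j) = refl

  record LieShaped (P : Poly n) : Set where
    field
      a-linear : ALinear (coeff P)
      binomial : ∀ i j → coeff P (aⁱbaʲ i j) ≡ sgn i * + ((i ℕ.+ j) C i) * coeff P (b ∷ a^ (i ℕ.+ j))
  open LieShaped

  binomial-zero : ∀ (P : Poly n) j → coeff P (aⁱbaʲ 0 j) ≡ sgn 0 * + (j C 0) * coeff P (b ∷ a^ j)
  binomial-zero P j = sym (ℤ.*-identityˡ (coeff P (b ∷ a^ j)))

  shaped-[] : LieShaped []
  shaped-[] = record
    { a-linear = record { at-ε = refl ; at-aa = λ _ → refl }
    ; binomial = λ i j → sym (ℤ.*-zeroʳ (sgn i * + ((i ℕ.+ j) C i))) }

  shaped-letter : ∀ x → LieShaped (letter x)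
  shaped-letter x = record
    { a-linear = record { at-ε = refl ; at-aa = λ r → coeff-letter-∷∷ x a a (a^ r) }
    ; binomial = binomial-letter }
    where
    vanish : ∀ i j → + 0 ≡ sgn i * + ((i ℕ.+ j) C i) * coeff (letter x) (b ∷ a ∷ a^ j)
    vanish i j = sym (trans (cong (sgn i * + ((i ℕ.+ j) C i) *_) (coeff-letter-∷∷ x b a (a^ j)))
                            (ℤ.*-zeroʳ (sgn i * + ((i ℕ.+ j) C i))))
    binomial-letter : ∀ i j →
      coeff (letter x) (aⁱbaʲ i j) ≡ sgn i * + ((i ℕ.+ j) C i) * coeff (letter x) (b ∷ a^ (i ℕ.+ j))
    binomial-letter zero j = binomial-zero (letter x) j
    binomial-letter (suc zero) j = trans (coeff-letter-∷∷ x a b (a^ j)) (vanish 1 j)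
    binomial-letter (suc (suc i)) j = trans (coeff-letter-∷∷ x a a (aⁱbaʲ i j)) (vanish (2 ℕ.+ i) j)

  shaped-++ : ∀ {P Q} → LieShaped P → LieShaped Q → LieShaped (P ⊕ Q)
  shaped-++ {P} {Q} SP SQ = record
    { a-linear = record
      { at-ε = trans (coeff-++ P Q []) (cong₂ _+_ (at-ε (a-linear SP)) (at-ε (a-linear SQ)))
      ; at-aa = λ r → trans (coeff-++ P Q _) (cong₂ _+_ (at-aa (a-linear SP) r) (at-aa (a-linear SQ) r)) }
    ; binomial = λ i j → let s = sgn i * + ((i ℕ.+ j) C i) in
        trans (coeff-++ P Q _)
          (trans (cong₂ _+_ (binomial SP i j) (binomial SQ i j))
            (trans (sym (ℤ.*-distribˡ-+ s _ _)) (cong (s *_) (sym (coeff-++ P Q _))))) }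

  shaped-· : ∀ c {P} → LieShaped P → LieShaped (c · P)
  shaped-· c {P} SP = record
    { a-linear = record
      { at-ε = trans (coeff-· c P []) (trans (cong (c *_) (at-ε (a-linear SP))) (ℤ.*-zeroʳ c))
      ; at-aa = λ r → trans (coeff-· c P _) (trans (cong (c *_) (at-aa (a-linear SP) r)) (ℤ.*-zeroʳ c)) }
    ; binomial = λ i j → let s = sgn i * + ((i ℕ.+ j) C i) in
        trans (coeff-· c P _)
          (trans (cong (c *_) (binomial SP i j))
            (trans (*-x∙yz≈y∙xz c s _) (cong (s *_) (sym (coeff-· c P _))))) }

  ⟦⟧-at-ba^ : ∀ P Q → ALinear (coeff P) → ALinear (coeff Q) → ∀ m →
    coeff ⟦ P , Q ⟧ (b ∷ a^ (suc m)) ≡ coeff P (b ∷ a^ m) * coeff Q [ a ] - coeff Q (b ∷ a^ m) * coeff P [ a ]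
  ⟦⟧-at-ba^ P Q LP LQ m = trans (coeff-⟦⟧ P Q (b ∷ a^ (suc m)))
    (cong₂ _-_ (trans (⋆-aⁱbaʲ LP LQ 0 (suc m)) (ℤ.+-identityˡ (coeff P (b ∷ a^ m) * coeff Q [ a ])))
               (trans (⋆-aⁱbaʲ LQ LP 0 (suc m)) (ℤ.+-identityˡ (coeff Q (b ∷ a^ m) * coeff P [ a ]))))

  lastSplit-shaped : ∀ {P} → LieShaped P → ∀ g i j →
    lastSplit (coeff P) g (suc i) j ≡ sgn (suc i) * + ((i ℕ.+ j) C suc i) * (coeff P (b ∷ a^ (i ℕ.+ j)) * g [ a ])
  lastSplit-shaped {P} SP g i zero = sym (begin
    sgn (suc i) * + ((i ℕ.+ 0) C suc i) * x
      ≡⟨ cong (λ c → sgn (suc i) * + c * x) (k>n⇒nCk≡0 (ℕ.s≤s (ℕ.≤-reflexive (ℕ.+-identityʳ i)))) ⟩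
    sgn (suc i) * + 0 * x
      ≡⟨ cong (_* x) (ℤ.*-zeroʳ (sgn (suc i))) ⟩
    + 0 ∎)
    where
    open ≡-Reasoning
    x = coeff P (b ∷ a^ (i ℕ.+ 0)) * g [ a ]
  lastSplit-shaped {P} SP g i (suc j) = begin
    coeff P (aⁱbaʲ (suc i) j) * g [ a ]
      ≡⟨ cong (_* g [ a ]) (binomial SP (suc i) j) ⟩
    sgn (suc i) * + ((suc i ℕ.+ j) C suc i) * coeff P (b ∷ a^ (suc i ℕ.+ j)) * g [ a ]
      ≡⟨ ℤ.*-assoc (sgn (suc i) * + ((suc i ℕ.+ j) C suc i)) _ _ ⟩
    sgn (suc i) * + ((suc i ℕ.+ j) C suc i) * (coeff P (b ∷ a^ (suc i ℕ.+ j)) * g [ a ])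
      ≡⟨ cong (λ k → sgn (suc i) * + (k C suc i) * (coeff P (b ∷ a^ k) * g [ a ])) (ℕ.+-suc i j) ⟨
    sgn (suc i) * + ((i ℕ.+ suc j) C suc i) * (coeff P (b ∷ a^ (i ℕ.+ suc j)) * g [ a ]) ∎
    where open ≡-Reasoning

  -- sgn (suc i) unfolds to - + 1 * sgn i
  bracket-identity : ∀ (pa qa p₀ q₀ s c₁ c₂ : ℤ) →
    pa * (s * c₁ * q₀) + (- + 1 * s) * c₂ * (p₀ * qa) - (qa * (s * c₁ * p₀) + (- + 1 * s) * c₂ * (q₀ * pa))
      ≡ (- + 1 * s) * (c₁ + c₂) * (p₀ * qa - q₀ * pa)
  bracket-identity = solve-∀

  shaped-⟦⟧ : ∀ {P Q} → LieShaped P → LieShaped Q → LieShaped ⟦ P , Q ⟧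
  shaped-⟦⟧ {P} {Q} SP SQ = record
    { a-linear = record { at-ε = at-ε′ ; at-aa = at-aa′ } ; binomial = binomial′ }
    where
    p q : Word n → ℤ
    p = coeff P
    q = coeff Q
    LP = a-linear SP
    LQ = a-linear SQ

    at-ε′ : coeff ⟦ P , Q ⟧ [] ≡ + 0
    at-ε′ = trans (coeff-⟦⟧ P Q []) (cong₂ (λ x y → x * y - y * x) (at-ε LP) (at-ε LQ))

    at-aa′ : ∀ r → coeff ⟦ P , Q ⟧ (a ∷ a ∷ a^ r) ≡ + 0
    at-aa′ r = trans (coeff-⟦⟧ P Q _) (trans (cong₂ _-_ (⋆-a^ LQ p (suc r)) (⋆-a^ LP q (suc r))) (cancel r))
      where
      cancel : ∀ r → p (a ∷ a^ r) * q [ a ] - q (a ∷ a^ r) * p [ a ] ≡ + 0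
      cancel zero =
        trans (cong (_-_ (p [ a ] * q [ a ])) (ℤ.*-comm (q [ a ]) (p [ a ]))) (ℤ.+-inverseʳ (p [ a ] * q [ a ]))
      cancel (suc r) = cong₂ (λ x y → x * q [ a ] - y * p [ a ]) (at-aa LP r) (at-aa LQ r)

    binomial′ : ∀ i j →
      coeff ⟦ P , Q ⟧ (aⁱbaʲ i j) ≡ sgn i * + ((i ℕ.+ j) C i) * coeff ⟦ P , Q ⟧ (b ∷ a^ (i ℕ.+ j))
    binomial′ zero j = binomial-zero ⟦ P , Q ⟧ j
    binomial′ (suc i) j = begin
      coeff ⟦ P , Q ⟧ (aⁱbaʲ (suc i) j)
        ≡⟨ coeff-⟦⟧ P Q _ ⟩
      (p ⋆ q) (aⁱbaʲ (suc i) j) - (q ⋆ p) (aⁱbaʲ (suc i) j)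
        ≡⟨ cong₂ _-_ (⋆-aⁱbaʲ LP LQ (suc i) j) (⋆-aⁱbaʲ LQ LP (suc i) j) ⟩
      p [ a ] * q (aⁱbaʲ i j) + lastSplit p q (suc i) j - (q [ a ] * p (aⁱbaʲ i j) + lastSplit q p (suc i) j)
        ≡⟨ cong₂ _-_ (cong₂ _+_ (cong (p [ a ] *_) (binomial SQ i j)) (lastSplit-shaped SP q i j))
                     (cong₂ _+_ (cong (q [ a ] *_) (binomial SP i j)) (lastSplit-shaped SQ p i j)) ⟩
      p [ a ] * (s * c₁ * q₀) + sgn (suc i) * c₂ * (p₀ * q [ a ])
        - (q [ a ] * (s * c₁ * p₀) + sgn (suc i) * c₂ * (q₀ * p [ a ]))
        ≡⟨ bracket-identity (p [ a ]) (q [ a ]) p₀ q₀ s c₁ c₂ ⟩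
      sgn (suc i) * (c₁ + c₂) * (p₀ * q [ a ] - q₀ * p [ a ])
        ≡⟨ cong₂ (λ c x → sgn (suc i) * + c * x)
                 (nCk+nC[k+1]≡[n+1]C[k+1] (i ℕ.+ j) i) (sym (⟦⟧-at-ba^ P Q LP LQ (i ℕ.+ j))) ⟩
      sgn (suc i) * + ((suc i ℕ.+ j) C suc i) * coeff ⟦ P , Q ⟧ (b ∷ a^ (suc i ℕ.+ j)) ∎
      where
      open ≡-Reasoning
      s = sgn i
      c₁ = + ((i ℕ.+ j) C i)
      c₂ = + ((i ℕ.+ j) C suc i)
      p₀ = p (b ∷ a^ (i ℕ.+ j))
      q₀ = q (b ∷ a^ (i ℕ.+ j))

  IsLie⇒LieShaped : ∀ {P} → IsLie P → LieShaped P
  IsLie⇒LieShaped (lie-letter x) = shaped-letter x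
  IsLie⇒LieShaped (lie-add P Q) = shaped-++ (IsLie⇒LieShaped P) (IsLie⇒LieShaped Q)
  IsLie⇒LieShaped (lie-smul c P) = shaped-· c (IsLie⇒LieShaped P)
  IsLie⇒LieShaped (lie-bracket P Q) = shaped-⟦⟧ (IsLie⇒LieShaped P) (IsLie⇒LieShaped Q)

  lrev-LieShaped : ∀ r → LieShaped (lrev r)
  lrev-LieShaped [] = shaped-[]
  lrev-LieShaped (x ∷ r) = IsLie⇒LieShaped (lrev-IsLie x r)

  lrev-at-letter : ∀ r z → coeff (lrev r) [ z ] ≡ δ r [ z ]
  lrev-at-letter [] z = refl
  lrev-at-letter (x ∷ []) z = coeff-letter x [ z ]
  lrev-at-letter (x ∷ y ∷ r) z =
    trans (coeff-⟦⟧ (lrev (y ∷ r)) (letter x) [ z ])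
      (trans (cong₂ _-_ (⋆-at-letter {f = p} {g = ℓ} ε₁ ε₂ z) (⋆-at-letter {f = ℓ} {g = p} ε₂ ε₁ z))
             (sym (mono-≢ {u = x ∷ y ∷ r} {w = [ z ]} (+ 1) λ ())))
    where
    p = coeff (lrev (y ∷ r))
    ℓ = coeff (letter x)
    ε₁ = at-ε (a-linear (lrev-LieShaped (y ∷ r)))
    ε₂ = at-ε (a-linear (shaped-letter x))

  aⁱbaʲ≢[] : ∀ i j → aⁱbaʲ i j ≢ []
  aⁱbaʲ≢[] zero j ()
  aⁱbaʲ≢[] (suc i) j ()

  δ-[x]-a∷aⁱbaʲ : ∀ x i j → δ [ x ] (a ∷ aⁱbaʲ i j) ≡ + 0
  δ-[x]-a∷aⁱbaʲ x i j = mono-≢ {u = [ x ]} {w = a ∷ aⁱbaʲ i j} (+ 1) (aⁱbaʲ≢[] i j ∘ sym ∘ ∷-injectiveʳ)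

  lrev-at-ba^ : ∀ m r → coeff (lrev r) (b ∷ a^ (suc m)) ≡ δ r (aⁱbaʲ (suc m) 0) - δ r (aⁱbaʲ m 1)
  lrev-at-ba^ m [] = sym (cong (_-_ (+ 0)) (mono-≢ (+ 1) (aⁱbaʲ≢[] m 1 ∘ sym)))
  lrev-at-ba^ zero (y ∷ []) = trans (coeff-letter-∷∷ y b a [])
    (sym (cong₂ _-_ (δ-[x]-a∷aⁱbaʲ y 0 0) (mono-≢ {u = [ y ]} {w = b ∷ a ∷ []} (+ 1) λ ())))
  lrev-at-ba^ (suc m) (y ∷ []) = trans (coeff-letter-∷∷ y b a (a^ (suc m)))
    (sym (cong₂ _-_ (δ-[x]-a∷aⁱbaʲ y (suc m) 0) (δ-[x]-a∷aⁱbaʲ y m 1)))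
  lrev-at-ba^ m (x ∷ y ∷ r) =
    trans (⟦⟧-at-ba^ (lrev (y ∷ r)) (letter x) (a-linear (lrev-LieShaped (y ∷ r))) (a-linear (shaped-letter x)) m)
      (expand m)
    where
    p = coeff (lrev (y ∷ r))
    ℓ = coeff (letter x)
    expand : ∀ m → p (b ∷ a^ m) * ℓ [ a ] - ℓ (b ∷ a^ m) * p [ a ]
                     ≡ δ (x ∷ y ∷ r) (aⁱbaʲ (suc m) 0) - δ (x ∷ y ∷ r) (aⁱbaʲ m 1)
    expand zero = begin
      p [ b ] * ℓ [ a ] - ℓ [ b ] * p [ a ]
        ≡⟨ cong₂ (λ u v → u * ℓ [ a ] - ℓ [ b ] * v) (lrev-at-letter (y ∷ r) b) (lrev-at-letter (y ∷ r) a) ⟩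
      δ (y ∷ r) [ b ] * ℓ [ a ] - ℓ [ b ] * δ (y ∷ r) [ a ]
        ≡⟨ cong₂ (λ u v → δ (y ∷ r) [ b ] * u - v * δ (y ∷ r) [ a ]) (coeff-letter x [ a ]) (coeff-letter x [ b ]) ⟩
      δ (y ∷ r) [ b ] * δ [ x ] [ a ] - δ [ x ] [ b ] * δ (y ∷ r) [ a ]
        ≡⟨ cong₂ _-_ (trans (ℤ.*-comm (δ (y ∷ r) [ b ]) (δ [ x ] [ a ])) (sym (δ-∷ x (y ∷ r) a [ b ])))
                     (sym (δ-∷ x (y ∷ r) b [ a ])) ⟩
      δ (x ∷ y ∷ r) (a ∷ b ∷ []) - δ (x ∷ y ∷ r) (b ∷ a ∷ []) ∎
      where open ≡-Reasoning
    expand (suc m) = begin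
      p (b ∷ a^ (suc m)) * ℓ [ a ] - ℓ (b ∷ a ∷ a^ m) * p [ a ]
        ≡⟨ cong₂ (λ u v → u * ℓ [ a ] - v * p [ a ]) (lrev-at-ba^ m (y ∷ r)) (coeff-letter-∷∷ x b a (a^ m)) ⟩
      (δ (y ∷ r) (aⁱbaʲ (suc m) 0) - δ (y ∷ r) (aⁱbaʲ m 1)) * ℓ [ a ] - + 0 * p [ a ]
        ≡⟨ distrib (δ (y ∷ r) (aⁱbaʲ (suc m) 0)) (δ (y ∷ r) (aⁱbaʲ m 1)) (ℓ [ a ]) (p [ a ]) ⟩
      ℓ [ a ] * δ (y ∷ r) (aⁱbaʲ (suc m) 0) - ℓ [ a ] * δ (y ∷ r) (aⁱbaʲ m 1)
        ≡⟨ cong (λ e → e * δ (y ∷ r) (aⁱbaʲ (suc m) 0) - e * δ (y ∷ r) (aⁱbaʲ m 1)) (coeff-letter x [ a ]) ⟩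
      δ [ x ] [ a ] * δ (y ∷ r) (aⁱbaʲ (suc m) 0) - δ [ x ] [ a ] * δ (y ∷ r) (aⁱbaʲ m 1)
        ≡⟨ cong₂ _-_ (δ-∷ x (y ∷ r) a (aⁱbaʲ (suc m) 0)) (δ-∷ x (y ∷ r) a (aⁱbaʲ m 1)) ⟨
      δ (x ∷ y ∷ r) (aⁱbaʲ (suc (suc m)) 0) - δ (x ∷ y ∷ r) (aⁱbaʲ (suc m) 1) ∎
      where
      open ≡-Reasoning
      distrib : ∀ (u v e w : ℤ) → (u - v) * e - + 0 * w ≡ e * u - e * v
      distrib = solve-∀

  a^-∷ʳ : ∀ N → a^ N ∷ʳ a ≡ a ∷ a^ N
  a^-∷ʳ zero = refl
  a^-∷ʳ (suc N) = cong (a ∷_) (a^-∷ʳ N)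

  reverse-a^ : ∀ N → reverse (a^ N) ≡ a^ N
  reverse-a^ zero = refl
  reverse-a^ (suc N) = trans (unfold-reverse a (a^ N)) (trans (cong (_∷ʳ a) (reverse-a^ N)) (a^-∷ʳ N))

  δ-reverseˡ : ∀ v {u w} → reverse u ≡ w → δ (reverse v) w ≡ δ v u
  δ-reverseˡ v {u} refl = δ-reverse v u

  lstar-aⁱbaʲ : ∀ i j v → lstar (aⁱbaʲ i j) v ≡ sgn i * + ((i ℕ.+ j) C i) * lstar (b ∷ a^ (i ℕ.+ j)) v
  lstar-aⁱbaʲ i j v = binomial (lrev-LieShaped (reverse v)) i j

  lstar-ba^ : ∀ N → N ≢ 0 → ∀ v → lstar (b ∷ a^ N) v ≡ δ v (b ∷ a^ N) - δ v (a ∷ b ∷ a^ (N ℕ.∸ 1))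
  lstar-ba^ zero 0≢0 v = contradiction refl 0≢0
  lstar-ba^ (suc m) _ v = trans (lrev-at-ba^ m (reverse v))
    (cong₂ _-_ (δ-reverseˡ v (trans (unfold-reverse b (a^ (suc m))) (cong (_∷ʳ b) (reverse-a^ (suc m)))))
               (δ-reverseˡ v (trans (reverse-++ (a ∷ b ∷ []) (a^ m)) (cong (_++ b ∷ a ∷ []) (reverse-a^ m)))))

  ∣sgn∣ : ∀ i → ∣ sgn i ∣ ≡ 1
  ∣sgn∣ zero = refl
  ∣sgn∣ (suc i) = trans (ℤ.abs-* (- + 1) (sgn i)) (trans (ℕ.*-identityˡ ∣ sgn i ∣) (∣sgn∣ i))

  ∣sgn*c*x∣ : ∀ i c x → ∣ sgn i * + c * x ∣ ≡ c ℕ.* ∣ x ∣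
  ∣sgn*c*x∣ i c x = begin
    ∣ sgn i * + c * x ∣        ≡⟨ ℤ.abs-* (sgn i * + c) x ⟩
    ∣ sgn i * + c ∣ ℕ.* ∣ x ∣  ≡⟨ cong (ℕ._* ∣ x ∣) (ℤ.abs-* (sgn i) (+ c)) ⟩
    ∣ sgn i ∣ ℕ.* c ℕ.* ∣ x ∣  ≡⟨ cong (λ s → s ℕ.* c ℕ.* ∣ x ∣) (∣sgn∣ i) ⟩
    1 ℕ.* c ℕ.* ∣ x ∣          ≡⟨ cong (ℕ._* ∣ x ∣) (ℕ.*-identityˡ c) ⟩
    c ℕ.* ∣ x ∣                ∎
    where open ≡-Reasoning

  l-IsLie : ∀ (w : Word n) → w ≢ [] → IsLie (l w)
  l-IsLie w w≢[] with reverse w in eq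
  ... | [] = contradiction (reverse-injective eq) w≢[]
  ... | x ∷ r = lrev-IsLie x r

  ∉support⇔∣binomial : a ≢ b → ∀ i j → i ℕ.+ j ≢ 0 → ∀ m →
    (¬ InSupportMod m (aⁱbaʲ i j)) ⇔ m ∣ (i ℕ.+ j) C i
  ∉support⇔∣binomial a≢b i j i+j≢0 m = mk⇔ ∉⇒∣ ∣⇒∉
    where
    N = i ℕ.+ j
    binom = N C i

    coeff-l-baᴺ : ∣ lstar (aⁱbaʲ i j) (b ∷ a^ N) ∣ ≡ binom
    coeff-l-baᴺ = begin
      ∣ lstar (aⁱbaʲ i j) (b ∷ a^ N) ∣
        ≡⟨ cong ∣_∣ (trans (lstar-aⁱbaʲ i j (b ∷ a^ N))
                           (cong (sgn i * + binom *_) (lstar-ba^ N i+j≢0 (b ∷ a^ N)))) ⟩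
      ∣ sgn i * + binom * (δ (b ∷ a^ N) (b ∷ a^ N) - δ (b ∷ a^ N) (a ∷ b ∷ a^ (N ℕ.∸ 1))) ∣
        ≡⟨ cong₂ (λ u v → ∣ sgn i * + binom * (u - v) ∣)
                 (mono-≡ {u = b ∷ a^ N} (+ 1) refl) (mono-∷-≢ (+ 1) (a^ N) (b ∷ a^ (N ℕ.∸ 1)) (a≢b ∘ sym)) ⟩
      ∣ sgn i * + binom * + 1 ∣
        ≡⟨ ∣sgn*c*x∣ i binom (+ 1) ⟩
      binom ℕ.* 1
        ≡⟨ ℕ.*-identityʳ binom ⟩
      binom ∎
      where open ≡-Reasoning

    ∉⇒∣ : ¬ InSupportMod m (aⁱbaʲ i j) → m ∣ binom
    ∉⇒∣ ∉ = subst (m ∣_) coeff-l-baᴺ (decidable-stable (m ∣? ∣ lstar (aⁱbaʲ i j) (b ∷ a^ N) ∣)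
      λ m∤ → ∉ (l (b ∷ a^ N) , l-IsLie (b ∷ a^ N) (λ ()) , m∤))

    ∣⇒∉ : m ∣ binom → ¬ InSupportMod m (aⁱbaʲ i j)
    ∣⇒∉ m∣binom (P , P-Lie , m∤) = m∤ (subst (m ∣_) coeff≡ (∣m⇒∣m*n _ m∣binom))
      where
      coeff≡ : binom ℕ.* _ ≡ ∣ coeff P (aⁱbaʲ i j) ∣
      coeff≡ = sym (trans (cong ∣_∣ (binomial (IsLie⇒LieShaped P-Lie) i j)) (∣sgn*c*x∣ i binom _))

module PrimePowers where

  open import Data.Nat
  open import Data.Nat.Properties
  open import Data.Nat.Divisibility
  open import Data.Nat.Primality using (Prime; euclidsLemma; prime⇒nonZero; prime⇒irreducible; ¬prime[1])
  open import Data.Nat.Tactic.RingSolver using (solve-∀)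
  open import Data.Sum using (inj₁; inj₂; [_,_]′)
  open import Relation.Nullary using (¬_; yes; no; contradiction)
  open import Relation.Binary.PropositionalEquality
  open import Function.Bundles using (_⇔_; mk⇔)

  ^-monoʳ-∣ : ∀ m {d c} → d ≤ c → m ^ d ∣ m ^ c
  ^-monoʳ-∣ m {d} {c} d≤c =
    divides (m ^ (c ∸ d)) (trans (cong (m ^_) (sym (m∸n+n≡m d≤c))) (^-distribˡ-+-* m (c ∸ d) d))

  module _ {p : ℕ} (prime : Prime p) where

    private instance
      p≢0 : NonZero p
      p≢0 = prime⇒nonZero prime

    prime∤1 : ¬ p ∣ 1
    prime∤1 p∣1 = ¬prime[1] (subst Prime (∣1⇒≡1 p∣1) prime)

    prime∤* : ∀ {m n} → ¬ p ∣ m → ¬ p ∣ n → ¬ p ∣ m * n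
    prime∤* {m} {n} p∤m p∤n p∣m*n = [ p∤m , p∤n ]′ (euclidsLemma m n prime p∣m*n)

    prime^∣*⇒∣ : ∀ e {m n} → ¬ p ∣ m → p ^ e ∣ m * n → p ^ e ∣ n
    prime^∣*⇒∣ zero {n = n} p∤m _ = 1∣ n
    prime^∣*⇒∣ (suc e) {m} {n} p∤m p^[1+e]∣m*n with euclidsLemma m n prime (∣-trans (m∣m*n (p ^ e)) p^[1+e]∣m*n)
    ... | inj₁ p∣m = contradiction p∣m p∤m
    ... | inj₂ (divides n′ refl) =
      subst (p * p ^ e ∣_) (*-comm p n′)
        (*-monoʳ-∣ p (prime^∣*⇒∣ e p∤m (*-cancelˡ-∣ p (subst (p * p ^ e ∣_) (reassoc m n′ p) p^[1+e]∣m*n))))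
      where
      reassoc : ∀ m n′ p → m * (n′ * p) ≡ p * (m * n′)
      reassoc = solve-∀

    prime∤prime^ : ∀ {q} e → Prime q → p ≢ q → ¬ p ∣ q ^ e
    prime∤prime^ zero _ _ = prime∤1
    prime∤prime^ {q} (suc e) q-prime p≢q p∣q^[1+e] with euclidsLemma q (q ^ e) prime p∣q^[1+e]
    ... | inj₂ p∣q^e = prime∤prime^ e q-prime p≢q p∣q^e
    ... | inj₁ p∣q with prime⇒irreducible q-prime p∣q
    ...   | inj₁ refl = prime∤1 ∣-refl
    ...   | inj₂ p≡q = p≢q p≡q

    p^∣⇔≤ : ∀ {x u w c} d → ¬ p ∣ u → ¬ p ∣ w → x * u ≡ p ^ c * w → (p ^ d ∣ x ⇔ d ≤ c)
    p^∣⇔≤ {x} {u} {w} {c} d p∤u p∤w x*u≡p^c*w = mk⇔ to from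
      where
      p^c∣x*u : p ^ c ∣ x * u
      p^c∣x*u = subst (p ^ c ∣_) (sym x*u≡p^c*w) (m∣m*n w)

      from : d ≤ c → p ^ d ∣ x
      from d≤c = prime^∣*⇒∣ d p∤u (subst (p ^ d ∣_) (*-comm x u) (∣-trans (^-monoʳ-∣ p d≤c) p^c∣x*u))

      to : p ^ d ∣ x → d ≤ c
      to p^d∣x with d ≤? c
      ... | yes d≤c = d≤c
      ... | no d≰c = contradiction (*-cancelˡ-∣ (p ^ c) {{m^n≢0 p c}} p^c*p∣p^c*w) p∤w
        where
        p^c*p∣p^c*w : p ^ c * p ∣ p ^ c * w
        p^c*p∣p^c*w = subst₂ _∣_ (*-comm p (p ^ c)) x*u≡p^c*w
                        (∣-trans (^-monoʳ-∣ p (≰⇒> d≰c)) (∣-trans p^d∣x (m∣m*n u)))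

module Kummer (q : ℕ) (prime : Prime (suc (suc q))) where

  open PrimePowers
  open import Data.Nat
  open import Data.Nat.Properties
  open import Data.Nat.DivMod
  open import Data.Nat.Divisibility
  open import Data.Nat.Combinatorics using (_C_; nCk≡n!/k![n-k]!; k![n∸k]!∣n!)
  open import Data.Nat.Tactic.RingSolver using (solve-∀)
  open import Data.Bool using (true; false; if_then_else_; T)
  open import Relation.Nullary using (¬_)
  open import Relation.Binary.PropositionalEquality
  open import Function.Bundles using (_⇔_)

  p : ℕ
  p = 2 + q

  1<p : 1 < p
  1<p = s≤s (s≤s z≤n)

  HasValuation : ℕ → ℕ → Set
  HasValuation x e = Σ ℕ λ u → ¬ p ∣ u × x ≡ p ^ e * u

  valuation-1 : HasValuation 1 0
  valuation-1 = 1 , prime∤1 prime , refl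

  -- the multiples of p up to r + t p are p, 2p, …, tp
  factorial-p-part : ∀ t r → r < p → Σ ℕ λ R → ¬ p ∣ R × (r + t * p) ! ≡ p ^ t * (t ! * R)
  factorial-p-part zero zero _ = 1 , prime∤1 prime , refl
  factorial-p-part (suc t) zero _ with factorial-p-part t (suc q) ≤-refl
  ... | R , p∤R , eq = R , p∤R , trans (cong ((p + t * p) *_) eq) (rearrange t p (p ^ t) (t !) R)
    where
    rearrange : ∀ t p P F R → (suc t * p) * (P * (F * R)) ≡ p * P * ((suc t * F) * R)
    rearrange = solve-∀
  factorial-p-part t (suc r) r<p with factorial-p-part t r (<⇒≤ r<p)
  ... | R , p∤R , eq = suc (r + t * p) * R , prime∤* prime p∤1+r+tp p∤R ,
                        trans (cong (suc (r + t * p) *_) eq) (rearrange (suc (r + t * p)) (p ^ t) (t !) R)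
    where
    rearrange : ∀ X P F R → X * (P * (F * R)) ≡ P * (F * (X * R))
    rearrange = solve-∀
    p∤1+r+tp : ¬ p ∣ suc r + t * p
    p∤1+r+tp p∣ = <⇒≱ r<p (∣⇒≤ (∣m+n∣m⇒∣n (subst (p ∣_) (+-comm (suc r) (t * p)) p∣) (n∣m*n t)))

  legendre : ∀ m e → HasValuation ((m / p) !) e → HasValuation (m !) (m / p + e)
  legendre m e (u , p∤u , [m/p]!≡) with factorial-p-part (m / p) (m % p) (m%n<n m p)
  ... | R , p∤R , block = u * R , prime∤* prime p∤u p∤R , (begin
    m !                              ≡⟨ cong _! (m≡m%n+[m/n]*n m p) ⟩
    (m % p + m / p * p) !            ≡⟨ block ⟩
    p ^ (m / p) * ((m / p) ! * R)    ≡⟨ cong (λ z → p ^ (m / p) * (z * R)) [m/p]!≡ ⟩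
    p ^ (m / p) * (p ^ e * u * R)    ≡⟨ rearrange (p ^ (m / p)) (p ^ e) u R ⟩
    p ^ (m / p) * p ^ e * (u * R)    ≡⟨ cong (_* (u * R)) (^-distribˡ-+-* p (m / p) e) ⟨
    p ^ (m / p + e) * (u * R)        ∎)
    where
    open ≡-Reasoning
    rearrange : ∀ A B U R → A * (B * U * R) ≡ A * B * (U * R)
    rearrange = solve-∀

  carryOut : ℕ → ℕ → ℕ → ℕ
  carryOut k l c = if p ≤ᵇ k % p + l % p + c then 1 else 0

  carryOut≤1 : ∀ k l c → carryOut k l c ≤ 1
  carryOut≤1 k l c with p ≤ᵇ k % p + l % p + c
  ... | true = s≤s z≤n
  ... | false = z≤n

  digitSum<2p : ∀ k l c → c ≤ 1 → k % p + l % p + c < p + p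
  digitSum<2p k l c c≤1 = begin-strict
    k % p + l % p + c     ≡⟨ +-assoc (k % p) (l % p) c ⟩
    k % p + (l % p + c)   ≤⟨ +-monoʳ-≤ (k % p) (≤-trans (+-monoʳ-≤ (l % p) c≤1) (≤-reflexive (+-comm (l % p) 1))) ⟩
    k % p + suc (l % p)   <⟨ +-mono-<-≤ (m%n<n k p) (m%n<n l p) ⟩
    p + p                 ∎
    where open ≤-Reasoning

  /p-below-2p : ∀ s → s < p + p → s / p ≡ (if p ≤ᵇ s then 1 else 0)
  /p-below-2p s s<2p with p ≤ᵇ s in p≤ᵇs
  ... | true = trans (m/n≡1+[m∸n]/n {s} {p} p≤s) (cong suc (m<n⇒m/n≡0 s∸p<p))
    where
    p≤s = ≤ᵇ⇒≤ p s (subst T (sym p≤ᵇs) _)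
    s∸p<p = +-cancelˡ-< p (s ∸ p) p (subst (_< p + p) (sym (m+[n∸m]≡n p≤s)) s<2p)
  ... | false = m<n⇒m/n≡0 {s} {p} (≰⇒> λ p≤s → subst T p≤ᵇs (≤⇒≤ᵇ p≤s))

  /p-carry : ∀ k l c → c ≤ 1 → (k + l + c) / p ≡ k / p + l / p + carryOut k l c
  /p-carry k l c c≤1 = begin
    (k + l + c) / p
      ≡⟨ cong (_/ p) (cong₂ (λ x y → x + y + c) (m≡m%n+[m/n]*n k p) (m≡m%n+[m/n]*n l p)) ⟩
    (k % p + k / p * p + (l % p + l / p * p) + c) / p
      ≡⟨ cong (_/ p) (rearrange (k % p) (l % p) c (k / p) (l / p) p) ⟩
    (s + t * p) / p       ≡⟨ +-distrib-/-∣ʳ s (n∣m*n t) ⟩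
    s / p + t * p / p     ≡⟨ cong₂ _+_ (/p-below-2p s (digitSum<2p k l c c≤1)) (m*n/n≡m t p) ⟩
    carryOut k l c + t    ≡⟨ +-comm (carryOut k l c) t ⟩
    t + carryOut k l c    ∎
    where
    open ≡-Reasoning
    s = k % p + l % p + c
    t = k / p + l / p
    rearrange : ∀ a b c x y p → a + x * p + (b + y * p) + c ≡ a + b + c + (x + y) * p
    rearrange = solve-∀

  carriesAux-zero : ∀ f c → c ≤ 1 → carriesAux f p c 0 0 ≡ 0
  carriesAux-zero zero c _ = refl
  carriesAux-zero (suc f) .0 z≤n = carriesAux-zero f 0 z≤n
  carriesAux-zero (suc f) .1 (s≤s z≤n) = carriesAux-zero f 0 z≤n

  -- Legendre's formula digit by digit: each carry makes (k + l + c)! one factor p richer than k! l!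
  record FactorialValuations (f k l c : ℕ) : Set where
    field
      e₁ e₂  : ℕ
      k!     : HasValuation (k !) e₁
      l!     : HasValuation (l !) e₂
      [k+l+c]! : HasValuation ((k + l + c) !) (e₁ + e₂ + carriesAux f p c k l)

  digitStep : ∀ f k l c → c ≤ 1 →
    FactorialValuations f (k / p) (l / p) (carryOut k l c) → FactorialValuations (suc f) k l c
  digitStep f k l c c≤1 V = record
    { e₁ = k / p + e₁ ; e₂ = l / p + e₂
    ; k! = legendre k e₁ k!
    ; l! = legendre l e₂ l!
    ; [k+l+c]! = subst (HasValuation ((k + l + c) !)) exponents (legendre (k + l + c) (e₁ + e₂ + X)
        (subst (λ z → HasValuation (z !) (e₁ + e₂ + X)) (sym (/p-carry k l c c≤1)) [k+l+c]!)) }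
    where
    open FactorialValuations V
    X = carriesAux f p (carryOut k l c) (k / p) (l / p)
    rearrange : ∀ a b o e₁ e₂ X → a + b + o + (e₁ + e₂ + X) ≡ a + e₁ + (b + e₂) + (o + X)
    rearrange = solve-∀
    exponents : (k + l + c) / p + (e₁ + e₂ + X) ≡ k / p + e₁ + (l / p + e₂) + (carryOut k l c + X)
    exponents = trans (cong (_+ (e₁ + e₂ + X)) (/p-carry k l c c≤1))
                      (rearrange (k / p) (l / p) (carryOut k l c) e₁ e₂ X)

  factorialValuations : ∀ f k l c → c ≤ 1 → k + l < f → FactorialValuations f k l c
  factorialValuations f zero zero c c≤1 _ = record
    { e₁ = 0 ; e₂ = 0 ; k! = valuation-1 ; l! = valuation-1
    ; [k+l+c]! = subst (HasValuation ((0 + 0 + c) !)) (sym (carriesAux-zero f c c≤1)) (c!≡1 c≤1) }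
    where
    c!≡1 : ∀ {c} → c ≤ 1 → HasValuation (c !) 0
    c!≡1 z≤n = valuation-1
    c!≡1 (s≤s z≤n) = valuation-1
  factorialValuations (suc f) (suc k) l c c≤1 (s≤s k+l<f) = digitStep f (suc k) l c c≤1
    (factorialValuations f _ _ _ (carryOut≤1 (suc k) l c)
      (<-≤-trans (+-mono-<-≤ (m/n<m (suc k) p 1<p) (m/n≤m l p)) k+l<f))
  factorialValuations (suc f) zero (suc l) c c≤1 (s≤s k+l<f) = digitStep f zero (suc l) c c≤1
    (factorialValuations f _ _ _ (carryOut≤1 0 (suc l) c)
      (<-≤-trans (+-mono-≤-< (m/n≤m 0 p) (m/n<m (suc l) p 1<p)) k+l<f))

  binomial*factorials : ∀ k l → ((k + l) C k) * (k ! * l !) ≡ (k + l) !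
  binomial*factorials k l = subst (λ z → ((k + l) C k) * (k ! * z !) ≡ (k + l) !) (m+n∸m≡n k l) C*k!*[n-k]!≡n!
    where
    instance _ = k !* ((k + l) ∸ k) !≢0
    C*k!*[n-k]!≡n! : ((k + l) C k) * (k ! * ((k + l) ∸ k) !) ≡ (k + l) !
    C*k!*[n-k]!≡n! = trans (cong (_* (k ! * ((k + l) ∸ k) !)) (nCk≡n!/k![n-k]! (m≤m+n k l)))
                          (m/n*n≡m (k![n∸k]!∣n! (m≤m+n k l)))

  kummer : ∀ k l e → p ^ e ∣ (k + l) C k ⇔ e ≤ carries p k l
  kummer k l e with factorialValuations (k + l + 1) k l 0 z≤n (m<m+n (k + l) (s≤s z≤n))
  ... | record { e₁ = e₁ ; e₂ = e₂ ; k! = u₁ , p∤u₁ , k!≡ ; l! = u₂ , p∤u₂ , l!≡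
               ; [k+l+c]! = u₃ , p∤u₃ , [k+l]!≡ } =
    p^∣⇔≤ prime e (prime∤* prime p∤u₁ p∤u₂) p∤u₃
      (*-cancelˡ-≡ _ _ (p ^ (e₁ + e₂)) {{m^n≢0 p (e₁ + e₂)}} (begin
        p ^ (e₁ + e₂) * (binom * (u₁ * u₂))    ≡⟨ cong (_* (binom * (u₁ * u₂))) (^-distribˡ-+-* p e₁ e₂) ⟩
        p ^ e₁ * p ^ e₂ * (binom * (u₁ * u₂))  ≡⟨ rearrange binom (p ^ e₁) (p ^ e₂) u₁ u₂ ⟩
        binom * (p ^ e₁ * u₁ * (p ^ e₂ * u₂))  ≡⟨ cong₂ (λ x y → binom * (x * y)) k!≡ l!≡ ⟨
        binom * (k ! * l !)                    ≡⟨ binomial*factorials k l ⟩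
        (k + l) !                              ≡⟨ cong _! (+-identityʳ (k + l)) ⟨
        (k + l + 0) !                          ≡⟨ [k+l]!≡ ⟩
        p ^ (e₁ + e₂ + c) * u₃                 ≡⟨ cong (_* u₃) (^-distribˡ-+-* p (e₁ + e₂) c) ⟩
        p ^ (e₁ + e₂) * p ^ c * u₃             ≡⟨ *-assoc (p ^ (e₁ + e₂)) (p ^ c) u₃ ⟩
        p ^ (e₁ + e₂) * (p ^ c * u₃)           ∎))
    where
    open ≡-Reasoning
    binom = (k + l) C k
    c = carries p k l
    rearrange : ∀ C A B u₁ u₂ → A * B * (C * (u₁ * u₂)) ≡ C * (A * u₁ * (B * u₂))
    rearrange = solve-∀

module PrimeFactorization where

  open PrimePowers
  open import Data.Nat
  open import Data.Nat.Divisibility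
  open import Data.Nat.Properties using (*-comm)
  open import Data.Nat.Primality using (Prime; ¬prime[0]; ¬prime[1])
  open import Data.Nat.Combinatorics using (_C_)
  open import Data.Nat.ListAction using (product)
  open import Data.List using (List; []; _∷_; map)
  open import Data.List.Relation.Unary.All using (All; []; _∷_)
  open import Data.List.Relation.Unary.AllPairs using (AllPairs; []; _∷_)
  open import Data.Product using (_×_; _,_; proj₁)
  open import Relation.Nullary using (¬_; contradiction)
  open import Relation.Binary.PropositionalEquality
  open import Function.Bundles using (_⇔_; mk⇔; Equivalence)
  open import Function.Properties.Equivalence using () renaming (trans to ⇔-trans)

  kummer-∣ : ∀ {p} e k l → Prime p → (p ^ e ∣ (k + l) C k ⇔ e ≤ carries p k l)
  kummer-∣ {0} _ _ _ p-prime = contradiction p-prime ¬prime[0]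
  kummer-∣ {1} _ _ _ p-prime = contradiction p-prime ¬prime[1]
  kummer-∣ {suc (suc q)} e k l p-prime = Kummer.kummer q p-prime k l e

  prime∤∏ : ∀ {p fs} → Prime p → All (λ { (q , f) → Prime q × 1 ≤ f }) fs → All (λ y → p ≢ proj₁ y) fs →
    ¬ p ∣ product (map (λ { (q , f) → q ^ f }) fs)
  prime∤∏ p-prime [] [] = prime∤1 p-prime
  prime∤∏ {fs = (q , f) ∷ _} p-prime ((q-prime , _) ∷ primes) (p≢q ∷ p≢fs) =
    prime∤* p-prime (prime∤prime^ p-prime f q-prime p≢q) (prime∤∏ p-prime primes p≢fs)

  ∏∣⇔prime-powers∣ : ∀ {fs} x →
    All (λ { (q , f) → Prime q × 1 ≤ f }) fs → AllPairs (λ y z → proj₁ y ≢ proj₁ z) fs →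
    (product (map (λ { (q , f) → q ^ f }) fs) ∣ x ⇔ All (λ { (p , e) → p ^ e ∣ x }) fs)
  ∏∣⇔prime-powers∣ x [] [] = mk⇔ (λ _ → []) (λ _ → 1∣ x)
  ∏∣⇔prime-powers∣ {(p , e) ∷ fs} x ((p-prime , _) ∷ primes) (p≢fs ∷ distinct) = mk⇔ to from
    where
    rest = product (map (λ { (q , f) → q ^ f }) fs)
    IH = ∏∣⇔prime-powers∣ x primes distinct

    to : p ^ e * rest ∣ x → All (λ { (p , e) → p ^ e ∣ x }) ((p , e) ∷ fs)
    to m∣x = ∣-trans (m∣m*n rest) m∣x ∷ Equivalence.to IH (∣-trans (n∣m*n (p ^ e)) m∣x)

    from : All (λ { (p , e) → p ^ e ∣ x }) ((p , e) ∷ fs) → p ^ e * rest ∣ x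
    from (p^e∣x ∷ powers∣x) with Equivalence.from IH powers∣x
    ... | divides t x≡t*rest =
      subst (p ^ e * rest ∣_) (sym x≡t*rest)
        (*-monoˡ-∣ rest (prime^∣*⇒∣ p-prime e (prime∤∏ p-prime primes p≢fs)
          (subst (p ^ e ∣_) (trans x≡t*rest (*-comm t rest)) p^e∣x)))

  All-⇔ : ∀ {A : Set} {P Q R : A → Set} {xs} →
    All R xs → (∀ {x} → R x → (P x ⇔ Q x)) → (All P xs ⇔ All Q xs)
  All-⇔ [] P⇔Q = mk⇔ (λ _ → []) (λ _ → [])
  All-⇔ (r ∷ rs) P⇔Q = mk⇔ (λ { (p ∷ ps) → Equivalence.to (P⇔Q r) p ∷ Equivalence.to (All-⇔ rs P⇔Q) ps })
                           (λ { (q ∷ qs) → Equivalence.from (P⇔Q r) q ∷ Equivalence.from (All-⇔ rs P⇔Q) qs })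

  ∣binomial⇔carries : ∀ {m fs} k l → IsPrimeFactorization m fs →
    (m ∣ (k + l) C k ⇔ All (λ { (p , e) → e ≤ carries p k l }) fs)
  ∣binomial⇔carries k l (primes , distinct , ∏≡m) =
    subst (λ m → m ∣ (k + l) C k ⇔ All (λ { (p , e) → e ≤ carries p k l }) _) ∏≡m
      (⇔-trans (∏∣⇔prime-powers∣ _ primes distinct)
               (All-⇔ primes λ { {p , e} (p-prime , _) → kummer-∣ e k l p-prime }))

open PrimeFactorization using (∣binomial⇔carries)
open import Data.Nat using (_+_; _∸_; _≤_)
open import Data.Nat.Properties using (m+n≡0⇒m≡0; m+n≡0⇒n≡0)
open import Data.Nat.Combinatorics using (_C_)
open import Data.Integer using (+_; -_; _*_; _-_; _^_)
open import Data.List.Relation.Unary.All using (All)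
open import Relation.Nullary using (¬_)
open import Function.Properties.Equivalence using () renaming (trans to ⇔-trans)

lemma2p7 : ∀ (n : ℕ) (a b : Fin n) → a ≢ b → ∀ (k l : ℕ) → ¬ (k ≡ 0 × l ≡ 0) →
  (∀ (v : Word n) →
    (lstar (replicate k a ++ b ∷ replicate l a) v
      ≡ ((- + 1) ^ k) * (+ ((k + l) C k)) * lstar (b ∷ replicate (k + l) a) v)
    × (lstar (replicate k a ++ b ∷ replicate l a) v
      ≡ ((- + 1) ^ k) * (+ ((k + l) C k))
        * ((if does (v ≟w (b ∷ replicate (k + l) a)) then + 1 else + 0)
           - (if does (v ≟w (a ∷ b ∷ replicate ((k + l) ∸ 1) a)) then + 1 else + 0))))
  × (∀ (m : ℕ) → 1 ≤ m → ∀ (fs : List (ℕ × ℕ)) → IsPrimeFactorization m fs →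
      ((¬ InSupportMod m (replicate k a ++ b ∷ replicate l a))
        ⇔ All (λ { (p , e) → e ≤ carries p k l }) fs))
lemma2p7 n a b a≢b k l ¬k≡0×l≡0 =
  (λ v → lstar-aⁱbaʲ k l v ,
         trans (lstar-aⁱbaʲ k l v) (cong (sgn k * + ((k + l) C k) *_) (lstar-ba^ (k + l) k+l≢0 v))) ,
  (λ m _ fs factorization →
    ⇔-trans (∉support⇔∣binomial a≢b k l k+l≢0 m) (∣binomial⇔carries k l factorization))
  where
  open LieShape a b
  k+l≢0 : k + l ≢ 0
  k+l≢0 k+l≡0 = ¬k≡0×l≡0 (m+n≡0⇒m≡0 k k+l≡0 , m+n≡0⇒n≡0 k k+l≡0)
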